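{- Fix $r\ge 3$ and $C>0$. For all sufficiently large $n$ the following holds. Let $v_1,\dots,v_r$ be integers with $|v_i-n|\le C\log n$ for all $i$ and $\sum_i v_i$ even. Let $c=\lfloor n/(r-1)\rfloor$, $d=\lfloor\sqrt{n\log n}\rfloor$, and let \[\mathcal{P}=\Big\{v=(v_{i,j})_{1\le i<j\le r}\in\mathbb{Z}^{\binom r2}:\ v_{i,j}\ge 0\ \forall i<j,\ \ \sum_{j\in[r]\setminus\{i\}}v_{i,j}=v_i\ \forall i\in[r]\Big\},\] where $v_{i,j}:=v_{j,i}$ for $i>j$. Then the set \[\mathcal{P}_0=\mathcal{P}\cap \prod_{1\le i<j\le r}(c-d,\,c+d]\] is non-empty.
   Context: The vectors in $\mathcal{P}$ are exactly the possible vectors of edge counts between parts $V_i,V_j$ of perfect matchings of the complete $r$-partite graph with parts of sizes $v_1,\dots,v_r$. The intervals $(a,b]$ denote integer intervals.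
   Formalization: The constant C ranges only over the positive rationals. -}

module Defs where

open import Data.Nat as ℕ using (ℕ; zero; suc; _+_; _*_; _∸_; _^_; _/_)
open import Data.Nat.Combinatorics using ()
open import Data.Nat using (_!)
open import Data.Integer as ℤ using (ℤ; +_)
open import Data.Fin using (Fin; zero; suc; _<_)
open import Data.Fin.Properties using (_≟_)
open import Relation.Nullary using (¬_; yes; no)
open import Relation.Nullary.Decidable using (⌊_⌋)
open import Data.Fin.Properties using (_<?_)
open import Data.Product using (_×_)

-- Exponential comparisons without reals.
-- expPartial x k = Σ_{j=0}^{k} x^j · k!/j!   ( = k! · Σ_{j≤k} x^j/j! )
expPartial : ℕ → ℕ → ℕ
expPartial x zero    = 1
expPartial x (suc k) = suc k * expPartial x k + x ^ suc k

-- ExpLe x N  means  e^x ≤ N  (real exponential), i.e. every partial sum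
-- Σ_{j≤k} x^j/j! of the exponential series is ≤ N.
-- For N ≥ 1 this is equivalent to  x ≤ ln N.
ExpLe : ℕ → ℕ → Set
ExpLe x N = (k : ℕ) → expPartial x k ℕ.≤ N * (k !)

-- d = ⌊ √(n · ln n) ⌋ :  d² ≤ n ln n < (d+1)²,
-- i.e. e^{d²} ≤ n^n and not e^{(d+1)²} ≤ n^n.
IsFloorSqrtNLogN : ℕ → ℕ → Set
IsFloorSqrtNLogN n d = ExpLe (d * d) (n ^ n) × ¬ ExpLe (suc d * suc d) (n ^ n)

-- c = ⌊ n / (r-1) ⌋ ; for r ≥ 3, suc (r ∸ 2) = r - 1.
cVal : ℕ → ℕ → ℕ
cVal n r = n / suc (r ∸ 2)

ΣFin : ∀ {r} → (Fin r → ℤ) → ℤ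
ΣFin {zero}  f = + 0
ΣFin {suc r} f = f zero ℤ.+ ΣFin (λ i → f (suc i))

-- Symmetrised entry: v_{i,j} for i<j is w i j, and v_{i,j} := v_{j,i} for i>j.
-- (Diagonal entries are never used below.)
vsym : ∀ {r} → (Fin r → Fin r → ℤ) → Fin r → Fin r → ℤ
vsym w i j with i <? j
... | yes _ = w i j
... | no  _ = w j i

rowSum : ∀ {r} → (Fin r → Fin r → ℤ) → Fin r → ℤ
rowSum w i = ΣFin (λ j → f j (i ≟ j))
  where
  f : ∀ j → _ → ℤ
  f j (yes _) = + 0
  f j (no  _) = vsym w i j

-- v = (v_{i,j})_{i<j} ∈ 𝒫 for degree vector vs
-- (only the entries w i j with i < j are meaningful).
In𝒫 : ∀ {r} → (Fin r → ℤ) → (Fin r → Fin r → ℤ) → Set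
In𝒫 vs w =
  ((i j : Fin _) → i < j → + 0 ℤ.≤ w i j) ×
  ((i : Fin _) → rowSum w i ≡ vs i)
  where open import Relation.Binary.PropositionalEquality using (_≡_)

InBox : ∀ {r} → ℕ → ℕ → (Fin r → Fin r → ℤ) → Set
InBox c d w = (i j : Fin _) → i < j →
  ((+ c ℤ.- + d) ℤ.< w i j) × (w i j ℤ.≤ (+ c ℤ.+ + d))

{-# OPTIONS --safe #-}

-- Write the entries as v_{ij} = c + e_{ij}.  The deviations δ_i = v_i - (r - 1) c have even sum
-- and |δ_i| ≤ |v_i - n| + r = O(log n), and any such vector is the degree sequence of a weighted
-- graph on r vertices with weights O(r max |δ_i|): join every vertex beyond the third to one
-- vertex of a triangle, which absorbs the remaining even total.  Both c ≈ n / (r - 1) and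
-- d ≈ √(n log n) dominate such weights for large n, so c + e_{ij} is a non-negative point of
-- the box.
module Submission where

open import Defs
open import Data.Nat as ℕ using (ℕ; suc; _≤_; _*_; _^_)
open import Data.Integer as ℤ using (ℤ; +_; ∣_∣)
open import Data.Integer.Divisibility using ()
open import Data.Fin using (Fin)
open import Data.Product using (Σ; ∃; _×_)
open import Relation.Binary.PropositionalEquality using (_≡_)

open import Data.Fin using (zero; suc)
open import Data.Fin.Patterns using (0F; 1F; 2F)
open import Data.Fin.Properties using (suc-injective; _≟_; _<?_)
open import Data.Product using (_,_; proj₁; proj₂)
open import Data.Empty using (⊥-elim)
open import Function using (_∘_)
open import Relation.Nullary using (¬_; yes; no)
open import Relation.Binary.PropositionalEquality using (refl; sym; trans; cong; cong₂; subst; module ≡-Reasoning)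
import Data.Nat.Properties as ℕP
import Data.Nat.DivMod as DM
import Data.Integer.Properties as ℤP

module ExponentialSeries where
  open import Data.Nat using (zero; _+_; _∸_; _!; z≤n; s≤s; NonZero; >-nonZero)
  open import Data.Nat.Properties
  open import Data.Nat.Solver using (module +-*-Solver)
  open +-*-Solver using (solve; _:+_; _:*_; con; _:=_)

  ^≤expPartial : ∀ x k → x ^ k ≤ expPartial x k
  ^≤expPartial x zero    = ≤-refl
  ^≤expPartial x (suc k) = m≤n+m (x ^ suc k) (suc k * expPartial x k)

  ExpLe⇒^≤ : ∀ {x N} → ExpLe x N → ∀ k → x ^ k ≤ N * k !
  ExpLe⇒^≤ {x} x≤lnN k = ≤-trans (^≤expPartial x k) (x≤lnN k)

  expPartial-monoˡ-≤ : ∀ {x y} → x ≤ y → ∀ k → expPartial x k ≤ expPartial y k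
  expPartial-monoˡ-≤ x≤y zero    = ≤-refl
  expPartial-monoˡ-≤ x≤y (suc k) =
    +-mono-≤ (*-monoʳ-≤ (suc k) (expPartial-monoˡ-≤ x≤y k)) (^-monoˡ-≤ (suc k) x≤y)

  ExpLe-monoˡ-≥ : ∀ {x y N} → x ≤ y → ExpLe y N → ExpLe x N
  ExpLe-monoˡ-≥ x≤y y≤lnN k = ≤-trans (expPartial-monoˡ-≤ x≤y k) (y≤lnN k)

  ExpLe-monoʳ-≤ : ∀ {x N N′} → N ≤ N′ → ExpLe x N → ExpLe x N′
  ExpLe-monoʳ-≤ N≤N′ x≤lnN k = ≤-trans (x≤lnN k) (*-monoˡ-≤ (k !) N≤N′)

  ^*!-step : ∀ X k → suc k * (suc X ^ k * k !) ≤ suc X ^ suc k * suc k !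
  ^*!-step X k = begin
      suc k * (suc X ^ k * k !)
    ≤⟨ m≤n*m _ (suc X) ⟩
      suc X * (suc k * (suc X ^ k * k !))
    ≡⟨ solve 4 (λ x k p f → x :* (k :* (p :* f)) := (x :* p) :* (k :* f)) refl (suc X) (suc k) (suc X ^ k) (k !) ⟩
      suc X ^ suc k * suc k !
    ∎
    where open ≤-Reasoning

  -- Each of the k + 1 terms x ^ j * k ! / j ! of expPartial x k is at most suc x ^ k * k !.
  expPartial≤ : ∀ x k → expPartial x k ≤ suc k * (suc x ^ k * k !)
  expPartial≤ x zero    = ≤-refl
  expPartial≤ x (suc k) = begin
      suc k * expPartial x k + x ^ suc k
    ≤⟨ +-mono-≤ (*-monoʳ-≤ (suc k) (expPartial≤ x k)) (^-monoˡ-≤ (suc k) (n≤1+n x)) ⟩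
      suc k * (suc k * (suc x ^ k * k !)) + suc x ^ suc k
    ≤⟨ +-mono-≤ (*-monoʳ-≤ (suc k) (^*!-step x k)) (m≤m*n (suc x ^ suc k) (suc k !) {{suc k !≢0}}) ⟩
      suc k * Q + Q
    ≡⟨ +-comm (suc k * Q) Q ⟩
      suc (suc k) * Q
    ∎
    where open ≤-Reasoning
          Q = suc x ^ suc k * suc k !

  expBound : ℕ → ℕ
  expBound x = (3 + 2 * x) * suc x ^ suc (2 * x)

  -- Beyond k = 2 x consecutive terms of the exponential series at least halve, which keeps
  -- this invariant.
  expPartial-tail : ∀ x j → let k = j + 2 * x in
    suc k * expPartial x k + 2 * x ^ suc k ≤ expBound x * suc k !
  expPartial-tail x zero = begin
      suc m * expPartial x m + 2 * x ^ suc m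
    ≤⟨ +-mono-≤ (*-monoʳ-≤ (suc m) (≤-trans (expPartial≤ x m) (^*!-step x m)))
                (*-monoʳ-≤ 2 (≤-trans (^-monoˡ-≤ (suc m) (n≤1+n x)) (m≤m*n _ (suc m !) {{suc m !≢0}}))) ⟩
      suc m * (suc x ^ suc m * suc m !) + 2 * (suc x ^ suc m * suc m !)
    ≡⟨ solve 3 (λ m p f → (con 1 :+ m) :* (p :* f) :+ con 2 :* (p :* f) := ((con 3 :+ m) :* p) :* f)
               refl m (suc x ^ suc m) (suc m !) ⟩
      expBound x * suc m !
    ∎
    where open ≤-Reasoning
          m = 2 * x
  expPartial-tail x (suc j) = begin
      suc (suc k) * (suc k * expPartial x k + x ^ suc k) + 2 * (x * x ^ suc k)
    ≡⟨ cong (_+_ (suc (suc k) * (suc k * expPartial x k + x ^ suc k))) (sym (*-assoc 2 x (x ^ suc k))) ⟩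
      suc (suc k) * (suc k * expPartial x k + x ^ suc k) + 2 * x * x ^ suc k
    ≤⟨ +-monoʳ-≤ (suc (suc k) * (suc k * expPartial x k + x ^ suc k)) (*-monoˡ-≤ (x ^ suc k) 2x≤2+k) ⟩
      suc (suc k) * (suc k * expPartial x k + x ^ suc k) + suc (suc k) * x ^ suc k
    ≡⟨ solve 3 (λ a e p → a :* (e :+ p) :+ a :* p := a :* (e :+ con 2 :* p))
               refl (suc (suc k)) (suc k * expPartial x k) (x ^ suc k) ⟩
      suc (suc k) * (suc k * expPartial x k + 2 * x ^ suc k)
    ≤⟨ *-monoʳ-≤ (suc (suc k)) (expPartial-tail x j) ⟩
      suc (suc k) * (expBound x * suc k !)
    ≡⟨ solve 3 (λ a b f → a :* (b :* f) := b :* (a :* f)) refl (suc (suc k)) (expBound x) (suc k !) ⟩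
      expBound x * suc (suc k) !
    ∎
    where open ≤-Reasoning
          k = j + 2 * x
          2x≤2+k : 2 * x ≤ suc (suc k)
          2x≤2+k = m≤n⇒m≤o+n 2 (m≤n+m (2 * x) j)

  ExpLe-expBound : ∀ x → ExpLe x (expBound x)
  ExpLe-expBound x k with k ≤? 2 * x
  ... | yes k≤2x = begin
      expPartial x k
    ≤⟨ expPartial≤ x k ⟩
      suc k * (suc x ^ k * k !)
    ≡⟨ sym (*-assoc (suc k) (suc x ^ k) (k !)) ⟩
      suc k * suc x ^ k * k !
    ≤⟨ *-monoˡ-≤ (k !) (*-mono-≤ (m≤n⇒m≤o+n 2 (s≤s k≤2x)) (^-monoʳ-≤ (suc x) (m≤n⇒m≤1+n k≤2x))) ⟩
      expBound x * k !
    ∎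
    where open ≤-Reasoning
  ... | no k≰2x = *-cancelˡ-≤ (suc k) (begin
      suc k * expPartial x k
    ≤⟨ m≤m+n _ _ ⟩
      suc k * expPartial x k + 2 * x ^ suc k
    ≡⟨ cong (λ t → suc t * expPartial x t + 2 * x ^ suc t) (sym j+2x≡k) ⟩
      suc (j + 2 * x) * expPartial x (j + 2 * x) + 2 * x ^ suc (j + 2 * x)
    ≤⟨ expPartial-tail x j ⟩
      expBound x * suc (j + 2 * x) !
    ≡⟨ cong (λ t → expBound x * suc t !) j+2x≡k ⟩
      expBound x * (suc k * k !)
    ≡⟨ solve 3 (λ b a f → b :* (a :* f) := a :* (b :* f)) refl (expBound x) (suc k) (k !) ⟩
      suc k * (expBound x * k !)
    ∎)
    where open ≤-Reasoning
          j = k ∸ 2 * x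
          j+2x≡k : j + 2 * x ≡ k
          j+2x≡k = m∸n+n≡m (<⇒≤ (≰⇒> k≰2x))

  ExpLe-n^n : ∀ x {n} → 3 + 2 * x ≤ n → ExpLe x (n ^ n)
  ExpLe-n^n x {n} 3+2x≤n = ExpLe-monoʳ-≤ expBound≤n^n (ExpLe-expBound x)
    where
    open ≤-Reasoning
    x+1≤n : suc x ≤ n
    x+1≤n = ≤-trans (m≤n⇒m≤o+n 2 (s≤s (m≤m+n x (x + 0)))) 3+2x≤n
    instance
      n≢0 : NonZero n
      n≢0 = >-nonZero (≤-trans (s≤s z≤n) x+1≤n)
    expBound≤n^n : expBound x ≤ n ^ n
    expBound≤n^n = begin
        (3 + 2 * x) * suc x ^ suc (2 * x)
      ≤⟨ *-mono-≤ 3+2x≤n (^-monoˡ-≤ (suc (2 * x)) x+1≤n) ⟩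
        n ^ (2 + 2 * x)
      ≤⟨ ^-monoʳ-≤ n (<⇒≤ 3+2x≤n) ⟩
        n ^ n
      ∎

  IsFloorSqrtNLogN-≥ : ∀ {n d y} → IsFloorSqrtNLogN n d → 3 + 2 * (y * y) ≤ n → y ≤ d
  IsFloorSqrtNLogN-≥ {n} {d} {y} (_ , d+1-too-big) 3+2y²≤n with y ≤? d
  ... | yes y≤d = y≤d
  ... | no  y≰d = ⊥-elim (d+1-too-big (ExpLe-monoˡ-≥ {N = n ^ n} (*-mono-≤ d<y d<y) (ExpLe-n^n (y * y) {n} 3+2y²≤n)))
    where d<y = ≰⇒> y≰d

module NaturalBounds where
  open import Data.Nat using (zero; _+_; _⊔_; z≤n; s≤s; NonZero; >-nonZero)
  open import Data.Nat.Properties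
  open import Data.Nat.Solver using (module +-*-Solver)
  open import Data.Sum using (inj₁; inj₂)
  open +-*-Solver using (solve; _:+_; _:*_; con; _:=_)

  ^-distribʳ-* : ∀ m n o → (m * n) ^ o ≡ m ^ o * n ^ o
  ^-distribʳ-* m n zero    = refl
  ^-distribʳ-* m n (suc o) rewrite ^-distribʳ-* m n o =
    solve 4 (λ m n a b → (m :* n) :* (a :* b) := (m :* a) :* (n :* b)) refl m n (m ^ o) (n ^ o)

  [x²]²^e≡x^[4e] : ∀ x e → (x * x * (x * x)) ^ e ≡ x ^ (4 * e)
  [x²]²^e≡x^[4e] x e = trans
    (cong (_^ e) (solve 1 (λ x → x :* x :* (x :* x) := x :* (x :* (x :* (x :* con 1)))) refl x))
    (^-*-assoc x 4 e)

  growth-threshold : ℕ → ℕ → ℕ → ℕ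
  growth-threshold e K D = suc ((D * D) ^ suc e * K)

  -- x ^ (4 e) ≤ n ^ e K says x = O(n ^ (1/4)), so D x² = O(n ^ (1/2)) is eventually below n.
  square≤-from-power-bound : ∀ e K D {n x} → growth-threshold e K D ≤ n →
    x ^ (4 * suc e) ≤ n ^ suc e * K → D * (x * x) ≤ n
  square≤-from-power-bound e K D {n} {x} N≤n x-small with D * (x * x) ≤? n
  ... | yes Dx²≤n = Dx²≤n
  ... | no Dx²≰n = ⊥-elim (<⇒≱ N≤n (≤-trans (m≤m*n n (n ^ e)) n^p≤D²ᵖK))
    where
    open ≤-Reasoning
    p = suc e
    instance
      n≢0 : NonZero n
      n≢0 = >-nonZero (≤-trans (s≤s z≤n) N≤n)
      n^e≢0 : NonZero (n ^ e)
      n^e≢0 = m^n≢0 n e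
      n^p≢0 : NonZero (n ^ p)
      n^p≢0 = m^n≢0 n p
    n≤Dx² : n ≤ D * (x * x)
    n≤Dx² = <⇒≤ (≰⇒> Dx²≰n)
    n^p≤D²ᵖK : n ^ p ≤ (D * D) ^ p * K
    n^p≤D²ᵖK = *-cancelˡ-≤ (n ^ p) (begin
        n ^ p * n ^ p
      ≡⟨ ^-distribʳ-* n n p ⟨
        (n * n) ^ p
      ≤⟨ ^-monoˡ-≤ p (*-mono-≤ n≤Dx² n≤Dx²) ⟩
        (D * (x * x) * (D * (x * x))) ^ p
      ≡⟨ cong (_^ p) (solve 2 (λ d x → d :* (x :* x) :* (d :* (x :* x)) := d :* d :* (x :* x :* (x :* x))) refl D x) ⟩
        (D * D * (x * x * (x * x))) ^ p
      ≡⟨ trans (^-distribʳ-* (D * D) _ p) (cong ((D * D) ^ p *_) ([x²]²^e≡x^[4e] x p)) ⟩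
        (D * D) ^ p * x ^ (4 * p)
      ≤⟨ *-monoʳ-≤ ((D * D) ^ p) x-small ⟩
        (D * D) ^ p * (n ^ p * K)
      ≡⟨ solve 3 (λ a b k → a :* (b :* k) := b :* (a :* k)) refl ((D * D) ^ p) (n ^ p) K ⟩
        n ^ p * ((D * D) ^ p * K)
      ∎)

  ∃-majorant : ∀ {r} (P : ℕ → Set) (f : Fin r → ℕ) {u} → P u → (∀ i → P (f i)) →
    ∃ λ U → P U × u ≤ U × (∀ i → f i ≤ U)
  ∃-majorant {zero}  P f {u} Pu Pf = u , Pu , ≤-refl , λ ()
  ∃-majorant {suc r} P f Pu Pf with ∃-majorant P (λ i → f (suc i)) Pu (λ i → Pf (suc i))
  ... | U , PU , u≤U , f≤U = f zero ⊔ U , P-max , ≤-trans u≤U (m≤n⊔m (f zero) U) , f≤max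
    where
    P-max : P (f zero ⊔ U)
    P-max with ⊔-sel (f zero) U
    ... | inj₁ eq = subst P (sym eq) (Pf zero)
    ... | inj₂ eq = subst P (sym eq) PU
    f≤max : ∀ i → f i ≤ f zero ⊔ U
    f≤max zero    = m≤m⊔n (f zero) U
    f≤max (suc i) = ≤-trans (f≤U i) (m≤n⊔m (f zero) U)

  even-suc-* : ∀ k → ∃ λ t → suc k * k ≡ 2 * t
  even-suc-* zero    = 0 , refl
  even-suc-* (suc k) with even-suc-* k
  ... | t , 1+k*k≡2t = t + suc k , (begin
      suc (suc k) * suc k        ≡⟨ solve 1 (λ k → (con 2 :+ k) :* (con 1 :+ k)
                                                  := (con 1 :+ k) :* k :+ con 2 :* (con 1 :+ k)) refl k ⟩
      suc k * k + 2 * suc k      ≡⟨ cong (_+ 2 * suc k) 1+k*k≡2t ⟩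
      2 * t + 2 * suc k          ≡⟨ *-distribˡ-+ 2 t (suc k) ⟨
      2 * (t + suc k)            ∎)
    where open ≡-Reasoning

  *≤⇒≤/ : ∀ {m n} k .{{_ : NonZero k}} → m * k ≤ n → m ≤ n ℕ./ k
  *≤⇒≤/ {m} k m*k≤n = ≤-trans (≤-reflexive (sym (DM.m*n/n≡m m k))) (DM./-monoˡ-≤ k m*k≤n)

  radius-square≤ : ∀ b {U} → 1 ≤ U →
    3 + 2 * (suc (b * (U + U)) * suc (b * (U + U))) ≤ (3 + 2 * ((2 * b + 1) * (2 * b + 1))) * (U * U)
  radius-square≤ b {U} 1≤U = begin
      3 + 2 * (y * y)
    ≤⟨ +-mono-≤ (*-monoʳ-≤ 3 (*-mono-≤ 1≤U 1≤U)) (*-monoʳ-≤ 2 (*-mono-≤ y≤aU y≤aU)) ⟩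
      3 * (U * U) + 2 * ((2 * b + 1) * U * ((2 * b + 1) * U))
    ≡⟨ solve 2 (λ b u → con 3 :* (u :* u) :+ con 2 :* ((con 2 :* b :+ con 1) :* u :* ((con 2 :* b :+ con 1) :* u))
                       := (con 3 :+ con 2 :* ((con 2 :* b :+ con 1) :* (con 2 :* b :+ con 1))) :* (u :* u)) refl b U ⟩
      (3 + 2 * ((2 * b + 1) * (2 * b + 1))) * (U * U)
    ∎
    where
    open ≤-Reasoning
    y = suc (b * (U + U))
    y≤aU : y ≤ (2 * b + 1) * U
    y≤aU = ≤-trans (+-monoˡ-≤ (b * (U + U)) 1≤U)
      (≤-reflexive (solve 2 (λ b u → u :+ b :* (u :+ u) := (con 2 :* b :+ con 1) :* u) refl b U))

module IntegerSums where
  open import Data.Integer using (_+_; _-_)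
  open ≡-Reasoning
  open import Algebra.Properties.CommutativeSemigroup ℤP.+-commutativeSemigroup using (interchange)

  ΣFin-cong : ∀ {r} {f g : Fin r → ℤ} → (∀ j → f j ≡ g j) → ΣFin f ≡ ΣFin g
  ΣFin-cong {ℕ.zero}  f≗g = refl
  ΣFin-cong {ℕ.suc r} f≗g = cong₂ _+_ (f≗g zero) (ΣFin-cong (λ j → f≗g (suc j)))

  ΣFin-+ : ∀ {r} (f g : Fin r → ℤ) → ΣFin (λ j → f j + g j) ≡ ΣFin f + ΣFin g
  ΣFin-+ {ℕ.zero}  f g = refl
  ΣFin-+ {ℕ.suc r} f g = trans (cong (_+_ (f zero + g zero)) (ΣFin-+ (λ j → f (suc j)) (λ j → g (suc j))))
                               (interchange (f zero) (g zero) _ _)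

  ΣFin-const : ∀ {r} (x : ℤ) → ΣFin {r} (λ _ → x) ≡ + r ℤ.* x
  ΣFin-const {ℕ.zero}  x = sym (ℤP.*-zeroˡ x)
  ΣFin-const {ℕ.suc r} x = begin
      x + ΣFin {r} (λ _ → x)    ≡⟨ cong (_+_ x) (ΣFin-const {r} x) ⟩
      x + + r ℤ.* x              ≡⟨ ℤP.suc-* (+ r) x ⟨
      + suc r ℤ.* x              ∎

  ΣFin-zero : ∀ {r} → ΣFin {r} (λ _ → + 0) ≡ + 0
  ΣFin-zero {r} = trans (ΣFin-const {r} (+ 0)) (ℤP.*-zeroʳ (+ r))

  ∣ΣFin∣≤ : ∀ {r M} (f : Fin r → ℤ) → (∀ j → ∣ f j ∣ ≤ M) → ∣ ΣFin f ∣ ≤ r * M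
  ∣ΣFin∣≤ {ℕ.zero}  f f≤M = ℕ.z≤n
  ∣ΣFin∣≤ {ℕ.suc r} f f≤M = ℕP.≤-trans (ℤP.∣i+j∣≤∣i∣+∣j∣ (f zero) _)
    (ℕP.+-mono-≤ (f≤M zero) (∣ΣFin∣≤ (λ j → f (suc j)) (λ j → f≤M (suc j))))

  ΣFin-skip : ∀ {r} (i : Fin r) {h g : Fin r → ℤ} → h i ≡ + 0 → (∀ j → ¬ i ≡ j → h j ≡ g j) →
    ΣFin h + g i ≡ ΣFin g
  ΣFin-skip zero {h} {g} hᵢ≡0 h≗g = begin
      (h zero + ΣFin (λ j → h (suc j))) + g zero
    ≡⟨ cong₂ (λ x y → (x + y) + g zero) hᵢ≡0 (ΣFin-cong (λ j → h≗g (suc j) λ ())) ⟩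
      (+ 0 + ΣFin (λ j → g (suc j))) + g zero
    ≡⟨ cong (_+ g zero) (ℤP.+-identityˡ (ΣFin (λ j → g (suc j)))) ⟩
      ΣFin (λ j → g (suc j)) + g zero
    ≡⟨ ℤP.+-comm _ (g zero) ⟩
      g zero + ΣFin (λ j → g (suc j))
    ∎
  ΣFin-skip (suc i) {h} {g} hᵢ≡0 h≗g = begin
      (h zero + ΣFin (λ j → h (suc j))) + g (suc i)
    ≡⟨ ℤP.+-assoc (h zero) _ _ ⟩
      h zero + (ΣFin (λ j → h (suc j)) + g (suc i))
    ≡⟨ cong₂ _+_ (h≗g zero λ ()) (ΣFin-skip i hᵢ≡0 (λ j i≢j → h≗g (suc j) (i≢j ∘ suc-injective))) ⟩
      g zero + ΣFin (λ j → g (suc j))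
    ∎

  vsym-symmetric : ∀ {r} (w : Fin r → Fin r → ℤ) → (∀ i j → w j i ≡ w i j) → ∀ i j → vsym w i j ≡ w i j
  vsym-symmetric w w-sym i j with i <? j
  ... | yes _ = refl
  ... | no  _ = w-sym i j

  -- The summand of rowSum is a where-bound function of Defs that cannot be named, so the
  -- statements of the two facts about it are left to unification with their use here.
  mutual
    rowSum-symmetric : ∀ {r} (w : Fin r → Fin r → ℤ) → (∀ i j → w j i ≡ w i j) →
      ∀ i → rowSum w i + w i i ≡ ΣFin (w i)
    rowSum-symmetric w w-sym i = ΣFin-skip i (rowSum-diagonal w i) (rowSum-off-diagonal w w-sym i)

    rowSum-diagonal : ∀ {r} (w : Fin r → Fin r → ℤ) i → _ ≡ + 0
    rowSum-diagonal w i with i ≟ i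
    ... | yes _   = refl
    ... | no  i≢i = ⊥-elim (i≢i refl)

    rowSum-off-diagonal : ∀ {r} (w : Fin r → Fin r → ℤ) → (∀ i j → w j i ≡ w i j) →
      ∀ i j → ¬ i ≡ j → _ ≡ w i j
    rowSum-off-diagonal w w-sym i j i≢j with i ≟ j
    ... | yes i≡j = ⊥-elim (i≢j i≡j)
    ... | no  _   = vsym-symmetric w w-sym i j

  rowSum-centred : ∀ {k} (c : ℕ) (E : Fin (suc k) → Fin (suc k) → ℤ) →
    (∀ i j → E j i ≡ E i j) → (∀ i → E i i ≡ + 0) →
    ∀ i → rowSum (λ i j → + c + E i j) i ≡ + (k * c) + ΣFin (E i)
  rowSum-centred {k} c E E-sym E-diag i = begin
      rowSum w i
    ≡⟨ solve 2 (λ x y → x := (x :+ y) :- y) refl (rowSum w i) (w i i) ⟩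
      (rowSum w i + w i i) - w i i
    ≡⟨ cong₂ _-_ (rowSum-symmetric w (λ i j → cong (_+_ (+ c)) (E-sym i j)) i) (cong (_+_ (+ c)) (E-diag i)) ⟩
      ΣFin (λ j → + c + E i j) - (+ c + + 0)
    ≡⟨ cong (_- (+ c + + 0)) (ΣFin-+ (λ _ → + c) (E i)) ⟩
      (ΣFin {suc k} (λ _ → + c) + ΣFin (E i)) - (+ c + + 0)
    ≡⟨ cong (λ x → (x + ΣFin (E i)) - (+ c + + 0)) Σc≡c+kc ⟩
      (+ c + + (k * c) + ΣFin (E i)) - (+ c + + 0)
    ≡⟨ solve 3 (λ x y e → (x :+ y :+ e) :- (x :+ con (+ 0)) := y :+ e) refl (+ c) (+ (k * c)) (ΣFin (E i)) ⟩
      + (k * c) + ΣFin (E i)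
    ∎
    where
    open import Data.Integer.Solver using (module +-*-Solver)
    open +-*-Solver using (solve; _:+_; _:-_; con; _:=_)
    w : Fin (suc k) → Fin (suc k) → ℤ
    w i j = + c + E i j
    Σc≡c+kc : ΣFin {suc k} (λ _ → + c) ≡ + c + + (k * c)
    Σc≡c+kc = trans (ΣFin-const {suc k} (+ c)) (trans (sym (ℤP.pos-* (suc k) c)) (ℤP.pos-+ c (k * c)))

open IntegerSums

pattern 3+_ k = suc (suc (suc k))

-- The triangle forces e₀₁ = (δ₀ + δ₁ - δ₂ - s) / 2, which is where the parity of ΣFin δ is needed.
module DeviationGraph {r′ : ℕ} (δ : Fin (3 ℕ.+ r′) → ℤ) (h : ℤ) (ΣFinδ≡2h : ΣFin δ ≡ + 2 ℤ.* h) where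
  open import Data.Integer using (_+_; _-_)
  open import Data.Integer.Solver using (module +-*-Solver)
  open +-*-Solver using (solve; _:+_; _:-_; _:*_; con; _:=_)

  δ₀ δ₁ δ₂ s e₀₁ e₀₂ e₁₂ : ℤ
  δ₀ = δ 0F
  δ₁ = δ 1F
  δ₂ = δ 2F
  s = ΣFin (λ k → δ (3+ k))
  e₀₁ = h - δ₂ - s
  e₀₂ = δ₀ - e₀₁
  e₁₂ = δ₂ - e₀₂

  E : Fin (3 ℕ.+ r′) → Fin (3 ℕ.+ r′) → ℤ
  E 0F     0F     = + 0
  E 0F     1F     = e₀₁
  E 0F     2F     = e₀₂
  E 0F     (3+ l) = + 0
  E 1F     0F     = e₀₁
  E 1F     1F     = + 0
  E 1F     2F     = e₁₂
  E 1F     (3+ l) = δ (3+ l)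
  E 2F     0F     = e₀₂
  E 2F     1F     = e₁₂
  E 2F     2F     = + 0
  E 2F     (3+ l) = + 0
  E (3+ k) 0F     = + 0
  E (3+ k) 1F     = δ (3+ k)
  E (3+ k) 2F     = + 0
  E (3+ k) (3+ l) = + 0

  E-symmetric : ∀ i j → E j i ≡ E i j
  E-symmetric 0F     0F     = refl
  E-symmetric 0F     1F     = refl
  E-symmetric 0F     2F     = refl
  E-symmetric 0F     (3+ l) = refl
  E-symmetric 1F     0F     = refl
  E-symmetric 1F     1F     = refl
  E-symmetric 1F     2F     = refl
  E-symmetric 1F     (3+ l) = refl
  E-symmetric 2F     0F     = refl
  E-symmetric 2F     1F     = refl
  E-symmetric 2F     2F     = refl
  E-symmetric 2F     (3+ l) = refl
  E-symmetric (3+ k) 0F     = refl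
  E-symmetric (3+ k) 1F     = refl
  E-symmetric (3+ k) 2F     = refl
  E-symmetric (3+ k) (3+ l) = refl

  E-diagonal : ∀ i → E i i ≡ + 0
  E-diagonal 0F     = refl
  E-diagonal 1F     = refl
  E-diagonal 2F     = refl
  E-diagonal (3+ k) = refl

  2e₀₁≡ : + 2 ℤ.* e₀₁ ≡ δ₀ + (δ₁ - (δ₂ + s))
  2e₀₁≡ = begin
      + 2 ℤ.* e₀₁
    ≡⟨ solve 3 (λ h d₂ s → con (+ 2) :* (h :- d₂ :- s) := con (+ 2) :* h :- (d₂ :+ s) :- (d₂ :+ s))
               refl h δ₂ s ⟩
      + 2 ℤ.* h - (δ₂ + s) - (δ₂ + s)
    ≡⟨ cong (λ x → x - (δ₂ + s) - (δ₂ + s)) ΣFinδ≡2h ⟨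
      ΣFin δ - (δ₂ + s) - (δ₂ + s)
    ≡⟨ solve 4 (λ d₀ d₁ d₂ s → d₀ :+ (d₁ :+ (d₂ :+ s)) :- (d₂ :+ s) :- (d₂ :+ s) := d₀ :+ (d₁ :- (d₂ :+ s)))
               refl δ₀ δ₁ δ₂ s ⟩
      δ₀ + (δ₁ - (δ₂ + s))
    ∎
    where open ≡-Reasoning

  E-row : ∀ i → ΣFin (E i) ≡ δ i
  E-row 0F rewrite ΣFin-zero {r′} =
    solve 2 (λ a d₀ → con (+ 0) :+ (a :+ ((d₀ :- a) :+ con (+ 0))) := d₀) refl e₀₁ δ₀
  E-row 1F = begin
      e₀₁ + (+ 0 + (e₁₂ + s))
    ≡⟨ solve 4 (λ a d₀ d₂ s → a :+ (con (+ 0) :+ ((d₂ :- (d₀ :- a)) :+ s)) := con (+ 2) :* a :+ (d₂ :+ s) :- d₀)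
               refl e₀₁ δ₀ δ₂ s ⟩
      + 2 ℤ.* e₀₁ + (δ₂ + s) - δ₀
    ≡⟨ cong (λ x → x + (δ₂ + s) - δ₀) 2e₀₁≡ ⟩
      δ₀ + (δ₁ - (δ₂ + s)) + (δ₂ + s) - δ₀
    ≡⟨ solve 3 (λ d₀ d₁ t → d₀ :+ (d₁ :- t) :+ t :- d₀ := d₁) refl δ₀ δ₁ (δ₂ + s) ⟩
      δ₁
    ∎
    where open ≡-Reasoning
  E-row 2F rewrite ΣFin-zero {r′} =
    solve 2 (λ b d₂ → b :+ ((d₂ :- b) :+ (con (+ 0) :+ con (+ 0))) := d₂) refl e₀₂ δ₂
  E-row (3+ k) rewrite ΣFin-zero {r′} =
    solve 1 (λ d → con (+ 0) :+ (d :+ (con (+ 0) :+ con (+ 0))) := d) refl (δ (3+ k))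

  module _ {M : ℕ} (δ≤M : ∀ i → ∣ δ i ∣ ≤ M) where
    ∣e₀₁∣≤ : ∣ e₀₁ ∣ ≤ (3 ℕ.+ r′) * M
    ∣e₀₁∣≤ = begin
        ∣ e₀₁ ∣
      ≤⟨ ℕP.m≤m+n ∣ e₀₁ ∣ _ ⟩
        2 * ∣ e₀₁ ∣
      ≡⟨ ℤP.abs-* (+ 2) e₀₁ ⟨
        ∣ + 2 ℤ.* e₀₁ ∣
      ≡⟨ cong ∣_∣ 2e₀₁≡ ⟩
        ∣ δ₀ + (δ₁ - (δ₂ + s)) ∣
      ≤⟨ ℤP.∣i+j∣≤∣i∣+∣j∣ δ₀ _ ⟩
        ∣ δ₀ ∣ ℕ.+ ∣ δ₁ - (δ₂ + s) ∣
      ≤⟨ ℕP.+-monoʳ-≤ ∣ δ₀ ∣ (ℤP.∣i-j∣≤∣i∣+∣j∣ δ₁ _) ⟩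
        ∣ δ₀ ∣ ℕ.+ (∣ δ₁ ∣ ℕ.+ ∣ δ₂ + s ∣)
      ≤⟨ ℕP.+-monoʳ-≤ ∣ δ₀ ∣ (ℕP.+-monoʳ-≤ ∣ δ₁ ∣ (ℤP.∣i+j∣≤∣i∣+∣j∣ δ₂ s)) ⟩
        ∣ δ₀ ∣ ℕ.+ (∣ δ₁ ∣ ℕ.+ (∣ δ₂ ∣ ℕ.+ ∣ s ∣))
      ≤⟨ ℕP.+-mono-≤ (δ≤M 0F) (ℕP.+-mono-≤ (δ≤M 1F) (ℕP.+-mono-≤ (δ≤M 2F) ∣s∣≤r′M)) ⟩
        (3 ℕ.+ r′) * M
      ∎
      where
      open ℕP.≤-Reasoning
      ∣s∣≤r′M : ∣ s ∣ ≤ r′ * M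
      ∣s∣≤r′M = ∣ΣFin∣≤ (λ k → δ (3+ k)) (λ k → δ≤M (3+ k))

    ∣e₀₂∣≤ : ∣ e₀₂ ∣ ≤ (4 ℕ.+ r′) * M
    ∣e₀₂∣≤ = ℕP.≤-trans (ℤP.∣i-j∣≤∣i∣+∣j∣ δ₀ e₀₁) (ℕP.+-mono-≤ (δ≤M 0F) ∣e₀₁∣≤)

    ∣e₁₂∣≤ : ∣ e₁₂ ∣ ≤ (5 ℕ.+ r′) * M
    ∣e₁₂∣≤ = ℕP.≤-trans (ℤP.∣i-j∣≤∣i∣+∣j∣ δ₂ e₀₂) (ℕP.+-mono-≤ (δ≤M 2F) ∣e₀₂∣≤)

    E-bound : ∀ i j → ∣ E i j ∣ ≤ (5 ℕ.+ r′) * M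
    E-bound 0F     0F     = ℕ.z≤n
    E-bound 0F     1F     = ℕP.≤-trans ∣e₀₁∣≤ (ℕP.*-monoˡ-≤ M (ℕP.m≤n+m (3 ℕ.+ r′) 2))
    E-bound 0F     2F     = ℕP.≤-trans ∣e₀₂∣≤ (ℕP.*-monoˡ-≤ M (ℕP.m≤n+m (4 ℕ.+ r′) 1))
    E-bound 0F     (3+ l) = ℕ.z≤n
    E-bound 1F     0F     = E-bound 0F 1F
    E-bound 1F     1F     = ℕ.z≤n
    E-bound 1F     2F     = ∣e₁₂∣≤
    E-bound 1F     (3+ l) = ℕP.≤-trans (δ≤M (3+ l)) (ℕP.m≤m+n M _)
    E-bound 2F     0F     = E-bound 0F 2F
    E-bound 2F     1F     = ∣e₁₂∣≤
    E-bound 2F     2F     = ℕ.z≤n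
    E-bound 2F     (3+ l) = ℕ.z≤n
    E-bound (3+ k) 0F     = ℕ.z≤n
    E-bound (3+ k) 1F     = E-bound 1F (3+ k)
    E-bound (3+ k) 2F     = ℕ.z≤n
    E-bound (3+ k) (3+ l) = ℕ.z≤n

module Centring where
  open import Data.Integer using (_+_; _-_; -_)
  open import Data.Integer.Solver using (module +-*-Solver)
  open +-*-Solver using (solve; _:+_; _:-_; _:*_; :-_; con; _:=_)

  ΣFin-centred-even : ∀ {k t} (vs : Fin (suc k) → ℤ) (c : ℕ) {m : ℤ} → suc k * k ≡ 2 * t →
    ΣFin vs ≡ + 2 ℤ.* m → ΣFin (λ i → vs i - + (k * c)) ≡ + 2 ℤ.* (m - + (t * c))
  ΣFin-centred-even {k} {t} vs c {m} 1+k*k≡2t Σvs≡2m = begin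
      ΣFin (λ i → vs i - + (k * c))
    ≡⟨ ΣFin-+ vs (λ _ → - + (k * c)) ⟩
      ΣFin vs + ΣFin {suc k} (λ _ → - + (k * c))
    ≡⟨ cong₂ _+_ Σvs≡2m (ΣFin-const {suc k} (- + (k * c))) ⟩
      + 2 ℤ.* m + + suc k ℤ.* - + (k * c)
    ≡⟨ cong (_+_ (+ 2 ℤ.* m)) (ℤP.neg-distribʳ-* (+ suc k) (+ (k * c))) ⟨
      + 2 ℤ.* m + - (+ suc k ℤ.* + (k * c))
    ≡⟨ cong (λ x → + 2 ℤ.* m + - x) r·kc≡2·tc ⟩
      + 2 ℤ.* m + - (+ 2 ℤ.* + (t * c))
    ≡⟨ solve 2 (λ m y → con (+ 2) :* m :+ :- (con (+ 2) :* y) := con (+ 2) :* (m :- y)) refl m (+ (t * c)) ⟩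
      + 2 ℤ.* (m - + (t * c))
    ∎
    where
    open ≡-Reasoning
    r·kc≡2·tc : + suc k ℤ.* + (k * c) ≡ + 2 ℤ.* + (t * c)
    r·kc≡2·tc = begin
      + suc k ℤ.* + (k * c)   ≡⟨ ℤP.pos-* (suc k) (k * c) ⟨
      + (suc k * (k * c))     ≡⟨ cong +_ (ℕP.*-assoc (suc k) k c) ⟨
      + (suc k * k * c)       ≡⟨ cong (λ x → + (x * c)) 1+k*k≡2t ⟩
      + (2 * t * c)           ≡⟨ cong +_ (ℕP.*-assoc 2 t c) ⟩
      + (2 * (t * c))         ≡⟨ ℤP.pos-* 2 (t * c) ⟩
      + 2 ℤ.* + (t * c)       ∎

  ∣∣≤⇒bounds : ∀ {R} (e : ℤ) → ∣ e ∣ ≤ R → - + R ℤ.≤ e × e ℤ.≤ + R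
  ∣∣≤⇒bounds (+ n)        n≤R           = ℤP.neg-≤-pos , ℤ.+≤+ n≤R
  ∣∣≤⇒bounds ℤ.-[1+ n ] (ℕ.s≤s n<R) = ℤ.-≤- n<R , ℤ.-≤+

  centred-in-box : ∀ {R} (c d : ℕ) (e : ℤ) → ∣ e ∣ ≤ R → R ℕ.< d → R ≤ c →
    (+ 0 ℤ.≤ + c + e) × ((+ c - + d) ℤ.< + c + e) × (+ c + e ℤ.≤ + c + + d)
  centred-in-box {R} c d e ∣e∣≤R R<d R≤c with ∣∣≤⇒bounds e ∣e∣≤R
  ... | -R≤e , e≤R =
    ℤP.≤-trans (ℤP.i≤j⇒0≤j-i (ℤ.+≤+ R≤c)) (ℤP.+-monoʳ-≤ (+ c) -R≤e) ,
    ℤP.+-monoʳ-< (+ c) (ℤP.<-≤-trans (ℤP.neg-mono-< (ℤ.+<+ R<d)) -R≤e) ,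
    ℤP.+-monoʳ-≤ (+ c) (ℤP.≤-trans e≤R (ℤ.+≤+ (ℕP.<⇒≤ R<d)))

  ∣n-k[n/k]∣<k : ∀ n k .{{_ : ℕ.NonZero k}} → ∣ + n - + (k * (n ℕ./ k)) ∣ ℕ.< k
  ∣n-k[n/k]∣<k n k = begin-strict
      ∣ + n - + (k * (n ℕ./ k)) ∣   ≡⟨ cong ∣_∣ (ℤP.[+m]-[+n]≡m⊖n n (k * (n ℕ./ k))) ⟩
      ∣ n ℤ.⊖ k * (n ℕ./ k) ∣       ≡⟨ ℤP.∣m⊖n∣≡∣n⊖m∣ n (k * (n ℕ./ k)) ⟩
      ∣ k * (n ℕ./ k) ℤ.⊖ n ∣       ≡⟨ ℤP.∣⊖∣-≤ (ℕP.≤-trans (ℕP.≤-reflexive (ℕP.*-comm k _)) (DM.m/n*n≤m n k)) ⟩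
      n ℕ.∸ k * (n ℕ./ k)           ≡⟨ cong (n ℕ.∸_) (ℕP.*-comm k _) ⟩
      n ℕ.∸ n ℕ./ k * k             ≡⟨ DM.m%n≡m∸m/n*n n k ⟨
      n ℕ.% k                       <⟨ DM.m%n<n n k ⟩
      k                             ∎
    where open ℕP.≤-Reasoning

  ∣v-k[n/k]∣≤ : ∀ (v : ℤ) n k .{{_ : ℕ.NonZero k}} → ∣ v - + (k * (n ℕ./ k)) ∣ ≤ ∣ v - + n ∣ ℕ.+ k
  ∣v-k[n/k]∣≤ v n k = begin
      ∣ v - + (k * (n ℕ./ k)) ∣
    ≡⟨ cong ∣_∣ (solve 3 (λ v x y → v :- y := (v :- x) :+ (x :- y)) refl v (+ n) (+ (k * (n ℕ./ k)))) ⟩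
      ∣ (v - + n) + (+ n - + (k * (n ℕ./ k))) ∣
    ≤⟨ ℤP.∣i+j∣≤∣i∣+∣j∣ (v - + n) _ ⟩
      ∣ v - + n ∣ ℕ.+ ∣ + n - + (k * (n ℕ./ k)) ∣
    ≤⟨ ℕP.+-monoʳ-≤ ∣ v - + n ∣ (ℕP.<⇒≤ (∣n-k[n/k]∣<k n k)) ⟩
      ∣ v - + n ∣ ℕ.+ k
    ∎
    where open ℕP.≤-Reasoning

open ExponentialSeries using (ExpLe⇒^≤; IsFloorSqrtNLogN-≥)
open NaturalBounds using (growth-threshold; square≤-from-power-bound; ∃-majorant; even-suc-*; *≤⇒≤/; radius-square≤)
open Centring using (ΣFin-centred-even; ∣v-k[n/k]∣≤; centred-in-box)

module Witness (r′ p′ q′ : ℕ) where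
  open import Data.Nat using (_+_; _<_; _!; z≤n; s≤s; NonZero; >-nonZero)
  open import Data.Nat.Properties

  r k p q : ℕ
  r = 3 + r′
  k = 2 + r′
  p = suc p′
  q = suc q′

  K D N : ℕ
  K = (4 * p) ! + r ^ (4 * p)
  D = 3 + 2 * ((2 * (5 + r′) + 1) * (2 * (5 + r′) + 1))
  N = growth-threshold p′ K D

  module Realisation {n : ℕ} (N≤n : N ≤ n) (vs : Fin r → ℤ)
    (close : ∀ i → ExpLe (q * ∣ vs i ℤ.- + n ∣) (n ^ p))
    {m : ℤ} (Σvs≡2m : ΣFin vs ≡ + 2 ℤ.* m) (d : ℕ) (floor : IsFloorSqrtNLogN n d) where

    c : ℕ
    c = cVal n r

    instance
      n^p≢0 : NonZero (n ^ p)
      n^p≢0 = m^n≢0 n p {{>-nonZero (≤-trans (s≤s z≤n) N≤n)}}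

    -- Of e ^ (q t) ≤ n ^ p only the single term t ^ (4 p) ≤ n ^ p (4 p)! of the series is used.
    Small : ℕ → Set
    Small u = u ^ (4 * p) ≤ n ^ p * K

    deviation-small : ∀ i → Small ∣ vs i ℤ.- + n ∣
    deviation-small i = ≤-trans (^-monoˡ-≤ (4 * p) (m≤n*m ∣ vs i ℤ.- + n ∣ q))
      (≤-trans (ExpLe⇒^≤ {N = n ^ p} (close i) (4 * p)) (*-monoʳ-≤ (n ^ p) (m≤m+n ((4 * p) !) (r ^ (4 * p)))))

    r-small : Small r
    r-small = ≤-trans (m≤n+m (r ^ (4 * p)) ((4 * p) !)) (m≤n*m K (n ^ p))

    majorant : ∃ λ U → Small U × r ≤ U × (∀ i → ∣ vs i ℤ.- + n ∣ ≤ U)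
    majorant = ∃-majorant Small (λ i → ∣ vs i ℤ.- + n ∣) r-small deviation-small

    U : ℕ
    U = proj₁ majorant
    U-small : Small U
    U-small = proj₁ (proj₂ majorant)
    k≤U : k ≤ U
    k≤U = ≤-trans (n≤1+n k) (proj₁ (proj₂ (proj₂ majorant)))
    deviation≤U : ∀ i → ∣ vs i ℤ.- + n ∣ ≤ U
    deviation≤U = proj₂ (proj₂ (proj₂ majorant))

    R : ℕ
    R = (5 + r′) * (U + U)

    3+2[1+R]²≤n : 3 + 2 * (suc R * suc R) ≤ n
    3+2[1+R]²≤n = ≤-trans (radius-square≤ (5 + r′) (≤-trans (s≤s z≤n) k≤U))
                          (square≤-from-power-bound p′ K D {n} {U} N≤n U-small)

    R<d : R < d
    R<d = IsFloorSqrtNLogN-≥ floor 3+2[1+R]²≤n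

    R≤c : R ≤ c
    R≤c = *≤⇒≤/ k (≤-trans (*-mono-≤ (n≤1+n R) k≤1+R) (≤-trans [1+R]²≤3+2[1+R]² 3+2[1+R]²≤n))
      where
      k≤1+R : k ≤ suc R
      k≤1+R = ≤-trans k≤U (≤-trans (m≤m+n U U) (≤-trans (m≤m+n (U + U) ((4 + r′) * (U + U))) (n≤1+n R)))
      [1+R]²≤3+2[1+R]² : suc R * suc R ≤ 3 + 2 * (suc R * suc R)
      [1+R]²≤3+2[1+R]² = ≤-trans (m≤n+m _ 3) (+-monoʳ-≤ 3 (m≤m+n (suc R * suc R) _))

    δ : Fin r → ℤ
    δ i = vs i ℤ.- + (k * c)

    Σδ-even : ΣFin δ ≡ + 2 ℤ.* (m ℤ.- + (proj₁ (even-suc-* k) * c))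
    Σδ-even = ΣFin-centred-even {t = proj₁ (even-suc-* k)} vs c (proj₂ (even-suc-* k)) Σvs≡2m

    open DeviationGraph δ _ Σδ-even using (E; E-symmetric; E-diagonal; E-row; E-bound)

    ∣δ∣≤ : ∀ i → ∣ δ i ∣ ≤ U + U
    ∣δ∣≤ i = ≤-trans (∣v-k[n/k]∣≤ (vs i) n k) (+-mono-≤ (deviation≤U i) k≤U)

    w : Fin r → Fin r → ℤ
    w i j = + c ℤ.+ E i j

    w-rows : ∀ i → rowSum w i ≡ vs i
    w-rows i = begin
        rowSum w i                          ≡⟨ rowSum-centred c E E-symmetric E-diagonal i ⟩
        + (k * c) ℤ.+ ΣFin (E i)            ≡⟨ cong (ℤ._+_ (+ (k * c))) (E-row i) ⟩
        + (k * c) ℤ.+ (vs i ℤ.- + (k * c))  ≡⟨ solve 2 (λ x v → x :+ (v :- x) := v) refl (+ (k * c)) (vs i) ⟩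
        vs i                                ∎
      where
      open ≡-Reasoning
      open import Data.Integer.Solver using (module +-*-Solver)
      open +-*-Solver using (solve; _:+_; _:-_; _:=_)

    w-box : ∀ i j → (+ 0 ℤ.≤ w i j) × ((+ c ℤ.- + d) ℤ.< w i j) × (w i j ℤ.≤ + c ℤ.+ + d)
    w-box i j = centred-in-box c d (E i j) (E-bound ∣δ∣≤ i j) R<d R≤c

lemma3p6 : (r : ℕ) → 3 ≤ r → (p q : ℕ) → 1 ≤ p → 1 ≤ q →
    ∃ λ N → (n : ℕ) → N ≤ n →
      (vs : Fin r → ℤ) →
      ((i : Fin r) → ExpLe (q * ∣ vs i ℤ.- + n ∣) (n ^ p)) →
      (Σ ℤ λ m → ΣFin vs ≡ + 2 ℤ.* m) →
      (d : ℕ) → IsFloorSqrtNLogN n d →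
      ∃ λ (w : Fin r → Fin r → ℤ) → In𝒫 vs w × InBox (cVal n r) d w
lemma3p6 (suc (suc (suc r′))) (ℕ.s≤s (ℕ.s≤s (ℕ.s≤s ℕ.z≤n))) (suc p′) (suc q′) _ _ =
  Witness.N r′ p′ q′ , λ n N≤n vs close (m , Σvs≡2m) d floor →
    let open Witness.Realisation r′ p′ q′ N≤n vs close Σvs≡2m d floor in
    w , ((λ i j _ → proj₁ (w-box i j)) , w-rows) , (λ i j _ → proj₂ (w-box i j))
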